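{- Let $(M,\le,0,1,+,\cdot,\mathrm{texp})$ be a model of $T^{dc}_{\mathrm{texp}}$ and let $\mathcal O\subseteq M$ be a convex subring with maximal ideal $\mathfrak m$ and group of units $\mathcal O^\times$. Then $\mathrm{texp}((-1,1))\subseteq\mathcal O^\times$ and $\mathrm{texp}(\mathfrak m)\subseteq 1+\mathfrak m$.
   Context: $T^{dc}_{\mathrm{texp}}$: models are the definably complete structures $(M,\le,0,1,+,\cdot,\mathrm{texp})$ (every nonempty definable-with-parameters subset bounded above has a supremum) where $(M,\le,0,1,+,\cdot)$ is an ordered field and $\mathrm{texp}:M\to M$ is differentiable on $(-1,1)$ with $\mathrm{texp}'(x)=\mathrm{texp}(x)$ there, $\mathrm{texp}(0)=1$, and $\mathrm{texp}(x)=0$ for $x\notin(-1,1)$. A convex subring is a subring (containing $1$) that is convex with respect to the order; it is a valuation ring with a unique maximal ideal. -}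

module Defs where

open import Data.Nat using (ℕ; suc)
open import Data.Fin using (Fin)
open import Data.Vec.Functional using (_∷_)
open import Data.Product using (Σ; _×_; ∃)
open import Data.Sum using (_⊎_)
open import Data.Empty using (⊥)
open import Relation.Nullary using (¬_)
open import Relation.Binary.PropositionalEquality using (_≡_; _≢_)
open import Algebra.Structures using (IsCommutativeRing)

data Term (n : ℕ) : Set where
  var  : Fin n → Term n
  zer  : Term n
  one  : Term n
  plus : Term n → Term n → Term n
  mult : Term n → Term n → Term n
  tex  : Term n → Term n

data Formula (n : ℕ) : Set where
  eqF  : Term n → Term n → Formula n
  leF  : Term n → Term n → Formula n
  botF : Formula n
  andF : Formula n → Formula n → Formula n
  orF  : Formula n → Formula n → Formula n
  impF : Formula n → Formula n → Formula n
  allF : Formula (suc n) → Formula n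
  exF  : Formula (suc n) → Formula n

-- Structures (M, ≤, 0, 1, +, ·, texp) with M an ordered field
-- (negation is part of the ring structure; it is definable anyway).

record TexpStructure : Set₁ where
  field
    M     : Set
    _≤_   : M → M → Set
    0#    : M
    1#    : M
    _+_   : M → M → M
    _*_   : M → M → M
    -_    : M → M
    texp  : M → M

  infix  4 _≤_ _<_
  infixl 6 _+_ _-_
  infixl 7 _*_

  _<_ : M → M → Set
  x < y = x ≤ y × x ≢ y

  _-_ : M → M → M
  x - y = x + (- y)

  AbsLt : M → M → Set
  AbsLt a b = (- b < a) × (a < b)

  InUnitInterval : M → Set
  InUnitInterval x = (- 1# < x) × (x < 1#)

  evalT : ∀ {n} → Term n → (Fin n → M) → M
  evalT (var i)    ρ = ρ i
  evalT zer        ρ = 0#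
  evalT one        ρ = 1#
  evalT (plus s t) ρ = evalT s ρ + evalT t ρ
  evalT (mult s t) ρ = evalT s ρ * evalT t ρ
  evalT (tex t)    ρ = texp (evalT t ρ)

  Sat : ∀ {n} → Formula n → (Fin n → M) → Set
  Sat (eqF s t)  ρ = evalT s ρ ≡ evalT t ρ
  Sat (leF s t)  ρ = evalT s ρ ≤ evalT t ρ
  Sat botF       ρ = ⊥
  Sat (andF φ ψ) ρ = Sat φ ρ × Sat ψ ρ
  Sat (orF φ ψ)  ρ = Sat φ ρ ⊎ Sat ψ ρ
  Sat (impF φ ψ) ρ = Sat φ ρ → Sat ψ ρ
  Sat (allF φ)   ρ = (x : M) → Sat φ (x ∷ ρ)
  Sat (exF φ)    ρ = Σ M λ x → Sat φ (x ∷ ρ)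

  DefSet : ∀ {k} → Formula (suc k) → (Fin k → M) → M → Set
  DefSet φ a x = Sat φ (x ∷ a)

  IsUpperBound : (M → Set) → M → Set
  IsUpperBound S b = ∀ x → S x → x ≤ b

  IsSupremum : (M → Set) → M → Set
  IsSupremum S s = IsUpperBound S s × (∀ b → IsUpperBound S b → s ≤ b)

  IsOrderedField : Set
  IsOrderedField =
    IsCommutativeRing _≡_ _+_ _*_ -_ 0# 1#
    × (0# ≢ 1#)
    × (∀ x → x ≢ 0# → Σ M λ y → x * y ≡ 1#)
    × (∀ x → x ≤ x)
    × (∀ x y z → x ≤ y → y ≤ z → x ≤ z)
    × (∀ x y → x ≤ y → y ≤ x → x ≡ y)
    × (∀ x y → x ≤ y ⊎ y ≤ x)
    × (∀ x y z → x ≤ y → x + z ≤ y + z)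
    × (∀ x y → 0# ≤ x → 0# ≤ y → 0# ≤ x * y)

  DefinablyComplete : Set
  DefinablyComplete =
    ∀ {k} (φ : Formula (suc k)) (a : Fin k → M) →
      (Σ M λ x → DefSet φ a x) →
      (Σ M λ b → IsUpperBound (DefSet φ a) b) →
      Σ M λ s → IsSupremum (DefSet φ a) s

  TexpDerivativeAxiom : Set
  TexpDerivativeAxiom =
    ∀ x → InUnitInterval x → ∀ ε → 0# < ε →
      Σ M λ δ → (0# < δ) ×
        (∀ h → 0# < h → h < δ →
           AbsLt (texp (x + h) - texp x - h * texp x) (ε * h))
        × (∀ h → - δ < h → h < 0# →
           AbsLt (texp (x + h) - texp x - h * texp x) (ε * (- h)))

  IsModel : Set
  IsModel =
    IsOrderedField
    × DefinablyComplete
    × TexpDerivativeAxiom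
    × (texp 0# ≡ 1#)
    × (∀ x → ¬ InUnitInterval x → texp x ≡ 0#)

  IsConvexSubring : (M → Set) → Set
  IsConvexSubring O =
    O 0# × O 1#
    × (∀ x y → O x → O y → O (x + y))
    × (∀ x → O x → O (- x))
    × (∀ x y → O x → O y → O (x * y))
    × (∀ x y z → O x → O z → x ≤ y → y ≤ z → O y)

  IsIdealOf : (M → Set) → (M → Set) → Set
  IsIdealOf O I =
    (∀ x → I x → O x)
    × I 0#
    × (∀ x y → I x → I y → I (x + y))
    × (∀ r x → O r → I x → I (r * x))

  IsProperIdealOf : (M → Set) → (M → Set) → Set
  IsProperIdealOf O I = IsIdealOf O I × ¬ I 1#

  IsMaximalIdealOf : (M → Set) → (M → Set) → Set₁
  IsMaximalIdealOf O 𝔪 =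
    IsProperIdealOf O 𝔪
    × ((J : M → Set) → IsProperIdealOf O J → (∀ x → 𝔪 x → J x) → ∀ x → J x → 𝔪 x)

  Units : (M → Set) → M → Set
  Units O x = O x × (Σ M λ y → O y × (x * y ≡ 1#))

-- Definable completeness gives continuous induction on [0,b] for definable
-- predicates, and with it a comparison principle: if f′ = σ f (σ = ±1) in the
-- ε-δ sense, g′ > σ g with a uniform margin and f 0 ≤ g 0, then f ≤ g on [0,b]
-- for b < 1.  Applied to ±texp(±u) it gives, for 0 ≤ u < 1,
--   1 ≤ texp u ≤ 1 + 2u + 2u²   and   ⅛ (8 - 12u + 5u²) ≤ texp (-u) ≤ 1,
-- so on (-1,1) texp takes values in [⅛, 5] and |texp x - 1| ≤ 4|x|.  A convex
-- subring contains everything between 0 and a natural number, hence texp x and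
-- its inverse lie in O.  The elements of O dominated by an element of 𝔪 form a
-- proper ideal containing 𝔪, so by maximality 𝔪 is convex, and texp x - 1 ∈ 𝔪
-- for x ∈ 𝔪.  As ≤ is not decidable, the comparisons only hold under double
-- negation; a little slack in the bounds recovers genuine inequalities.

module Submission where

open import Defs
open import Algebra.Bundles using (CommutativeRing)
open import Data.Empty using (⊥-elim)
open import Data.Fin using (Fin; zero; suc; lift; _↑ʳ_)
open import Data.Integer as ℤ using (ℤ; -[1+_]; _⊖_; _◃_; sign; ∣_∣)
import Data.Integer.Properties as ℤ
open import Data.Maybe using (Maybe; map)
open import Data.Nat as ℕ using (ℕ; zero; suc)
import Data.Nat.Properties as ℕ
open import Data.Product using (Σ; Σ-syntax; _×_; _,_; proj₁; proj₂)
open import Data.Sign as Sign using (Sign)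
open import Data.Sum using (_⊎_; inj₁; inj₂; [_,_]′)
open import Data.Vec.Functional using (_∷_; [])
open import Effect.Monad using (RawMonad)
import Level
open import Function using (id; _∘_)
open import Relation.Binary.PropositionalEquality as ≡ using (_≡_; _≢_; cong; cong₂; subst; subst₂)
open import Relation.Binary.Bundles using (Poset)
import Relation.Binary.Reasoning.PartialOrder as PartialOrderReasoning
open import Relation.Nullary using (¬_; yes; no)
open import Relation.Nullary.Decidable using (dec⇒maybe; ¬¬-excluded-middle)
open import Relation.Nullary.Negation using (Stable; ¬¬-Monad; negated-stable; contradiction)

open RawMonad (¬¬-Monad {a = Level.zero}) using (pure; _>>=_; _<$>_)

-- The ring solvers of the library take their coefficients from the ring itself,
-- so in an abstract ring they cannot cancel 1 - 1; over ℤ normal forms are canonical.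
module IntegerCoefficientRingSolver {c ℓ} (R : CommutativeRing c ℓ) where
  open CommutativeRing R
  open import Algebra.Properties.Ring ring using (-0#≈0#; -‿involutive; -‿+-comm; -1*x≈-x)
  open import Algebra.Properties.CommutativeSemigroup +-commutativeSemigroup
    using () renaming (interchange to +-interchange)
  open import Algebra.Properties.CommutativeSemigroup *-commutativeSemigroup
    using () renaming (interchange to *-interchange)
  open import Algebra.Properties.Semiring.Mult.TCOptimised semiring
    using (×-homo-+; ×1-homo-*) renaming (_×_ to _×′_; 1+× to ×′-suc)
  open import Algebra.Solver.Ring.AlmostCommutativeRing
    using (fromCommutativeRing; _-Raw-AlmostCommutative⟶_)
  open import Relation.Binary.Reasoning.Setoid setoid

  fromℕ : ℕ → Carrier
  fromℕ n = n ×′ 1#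

  fromℕ-suc : ∀ n → fromℕ (suc n) ≈ 1# + fromℕ n
  fromℕ-suc n = ×′-suc n 1#

  fromℤ : ℤ → Carrier
  fromℤ (ℤ.+ n)  = fromℕ n
  fromℤ -[1+ n ] = - fromℕ (suc n)

  fromℤ-neg : ∀ i → fromℤ (ℤ.- i) ≈ - fromℤ i
  fromℤ-neg (ℤ.+ zero)  = sym -0#≈0#
  fromℤ-neg (ℤ.+ suc n) = refl
  fromℤ-neg -[1+ n ]    = sym (-‿involutive _)

  fromℤ-⊖ : ∀ m n → fromℤ (m ⊖ n) ≈ fromℕ m - fromℕ n
  fromℤ-⊖ zero    zero    = sym (-‿inverseʳ 0#)
  fromℤ-⊖ (suc m) zero    = begin
    fromℕ (suc m)       ≈⟨ +-identityʳ _ ⟨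
    fromℕ (suc m) + 0#  ≈⟨ +-congˡ -0#≈0# ⟨
    fromℕ (suc m) - 0#  ∎
  fromℤ-⊖ zero    (suc n) = sym (+-identityˡ _)
  fromℤ-⊖ (suc m) (suc n) = begin
    fromℤ (suc m ⊖ suc n)              ≡⟨ cong fromℤ (ℤ.[1+m]⊖[1+n]≡m⊖n m n) ⟩
    fromℤ (m ⊖ n)                      ≈⟨ fromℤ-⊖ m n ⟩
    fromℕ m - fromℕ n                  ≈⟨ +-identityˡ _ ⟨
    0# + (fromℕ m - fromℕ n)           ≈⟨ +-congʳ (-‿inverseʳ 1#) ⟨
    (1# - 1#) + (fromℕ m - fromℕ n)    ≈⟨ +-interchange _ _ _ _ ⟩
    (1# + fromℕ m) + (- 1# - fromℕ n)  ≈⟨ +-congˡ (-‿+-comm 1# (fromℕ n)) ⟩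
    (1# + fromℕ m) - (1# + fromℕ n)    ≈⟨ +-cong (fromℕ-suc m) (-‿cong (fromℕ-suc n)) ⟨
    fromℕ (suc m) - fromℕ (suc n)      ∎

  fromℤ-+ : ∀ i j → fromℤ (i ℤ.+ j) ≈ fromℤ i + fromℤ j
  fromℤ-+ (ℤ.+ m)  (ℤ.+ n)  = ×-homo-+ 1# m n
  fromℤ-+ (ℤ.+ m)  -[1+ n ] = fromℤ-⊖ m (suc n)
  fromℤ-+ -[1+ m ] (ℤ.+ n)  = trans (fromℤ-⊖ n (suc m)) (+-comm _ _)
  fromℤ-+ -[1+ m ] -[1+ n ] = begin
    - fromℕ (suc (suc (m ℕ.+ n)))      ≡⟨ cong (λ k → - fromℕ (suc k)) (ℕ.+-suc m n) ⟨
    - fromℕ (suc m ℕ.+ suc n)          ≈⟨ -‿cong (×-homo-+ 1# (suc m) (suc n)) ⟩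
    - (fromℕ (suc m) + fromℕ (suc n))  ≈⟨ -‿+-comm _ _ ⟨
    - fromℕ (suc m) - fromℕ (suc n)    ∎

  fromSign : Sign → Carrier
  fromSign Sign.+ = 1#
  fromSign Sign.- = - 1#

  fromSign-* : ∀ s t → fromSign (s Sign.* t) ≈ fromSign s * fromSign t
  fromSign-* Sign.+ t      = sym (*-identityˡ _)
  fromSign-* Sign.- Sign.+ = sym (*-identityʳ _)
  fromSign-* Sign.- Sign.- = sym (trans (-1*x≈-x (- 1#)) (-‿involutive 1#))

  fromℤ-◃ : ∀ s n → fromℤ (s ◃ n) ≈ fromSign s * fromℕ n
  fromℤ-◃ s      zero    = sym (zeroʳ _)
  fromℤ-◃ Sign.+ (suc n) = sym (*-identityˡ _)
  fromℤ-◃ Sign.- (suc n) = sym (-1*x≈-x _)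

  fromℤ-signAbs : ∀ i → fromℤ i ≈ fromSign (sign i) * fromℕ ∣ i ∣
  fromℤ-signAbs i = trans (reflexive (cong fromℤ (≡.sym (ℤ.◃-inverse i)))) (fromℤ-◃ (sign i) ∣ i ∣)

  fromℤ-* : ∀ i j → fromℤ (i ℤ.* j) ≈ fromℤ i * fromℤ j
  fromℤ-* i j = begin
    fromℤ (sign i Sign.* sign j ◃ ∣ i ∣ ℕ.* ∣ j ∣)
      ≈⟨ fromℤ-◃ (sign i Sign.* sign j) (∣ i ∣ ℕ.* ∣ j ∣) ⟩
    fromSign (sign i Sign.* sign j) * fromℕ (∣ i ∣ ℕ.* ∣ j ∣)
      ≈⟨ *-cong (fromSign-* (sign i) (sign j)) (×1-homo-* ∣ i ∣ ∣ j ∣) ⟩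
    (fromSign (sign i) * fromSign (sign j)) * (fromℕ ∣ i ∣ * fromℕ ∣ j ∣)
      ≈⟨ *-interchange _ _ _ _ ⟩
    (fromSign (sign i) * fromℕ ∣ i ∣) * (fromSign (sign j) * fromℕ ∣ j ∣)
      ≈⟨ *-cong (fromℤ-signAbs i) (fromℤ-signAbs j) ⟨
    fromℤ i * fromℤ j
      ∎

  fromℤ-homomorphism : ℤ.+-*-rawRing -Raw-AlmostCommutative⟶ fromCommutativeRing R
  fromℤ-homomorphism = record
    { ⟦_⟧    = fromℤ
    ; +-homo = fromℤ-+
    ; *-homo = fromℤ-*
    ; -‿homo = fromℤ-neg
    ; 0-homo = refl
    ; 1-homo = refl
    }

  fromℤ-weakly≟ : ∀ i j → Maybe (fromℤ i ≈ fromℤ j)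
  fromℤ-weakly≟ i j = map (reflexive ∘ cong fromℤ) (dec⇒maybe (i ℤ.≟ j))

  open import Algebra.Solver.Ring ℤ.+-*-rawRing (fromCommutativeRing R) fromℤ-homomorphism fromℤ-weakly≟ public
    using (Polynomial; con; _:+_; _:*_; :-_; _:-_; solve; _:=_)

  lit : ∀ {n} → ℕ → Polynomial n
  lit n = con (ℤ.+ n)

renameTerm : ∀ {m n} → (Fin m → Fin n) → Term m → Term n
renameTerm r (var i)    = var (r i)
renameTerm r zer        = zer
renameTerm r one        = one
renameTerm r (plus s t) = plus (renameTerm r s) (renameTerm r t)
renameTerm r (mult s t) = mult (renameTerm r s) (renameTerm r t)
renameTerm r (tex t)    = tex (renameTerm r t)

-- Left-nested like fromℕ, so that evalT (numeral n) reduces to fromℕ n.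
numeral : ∀ {n} → ℕ → Term n
numeral 0               = zer
numeral 1               = one
numeral (suc n@(suc _)) = plus (numeral n) one

module _ (𝓜 : TexpStructure) where
  open TexpStructure 𝓜

  module OrderedFieldProperties (ordered : IsOrderedField) where

    commutativeRing : CommutativeRing Level.zero Level.zero
    commutativeRing = record { isCommutativeRing = proj₁ ordered }

    open CommutativeRing commutativeRing public
      using (+-comm; +-identityˡ; +-identityʳ; -‿inverseʳ; *-comm; *-assoc; *-identityˡ; *-identityʳ; zeroˡ; zeroʳ)
    open IntegerCoefficientRingSolver commutativeRing public
      using (fromℕ; fromℕ-suc; fromSign; Polynomial; solve; _:=_; _:+_; _:*_; :-_; _:-_; lit)
    open import Algebra.Properties.Ring (CommutativeRing.ring commutativeRing) public
      using (-0#≈0#; -‿involutive; -‿+-comm; -‿distribʳ-*; -1*x≈-x)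

    private
      variable
        x y z u v : M

    0≢1 : 0# ≢ 1#
    0≢1 = let (_ , 0≢1 , _) = ordered in 0≢1

    *-inverse : x ≢ 0# → Σ[ y ∈ M ] x * y ≡ 1#
    *-inverse = let (_ , _ , inverse , _) = ordered in inverse _

    ≤-refl : x ≤ x
    ≤-refl = let (_ , _ , _ , refl , _) = ordered in refl _

    ≤-trans : x ≤ y → y ≤ z → x ≤ z
    ≤-trans = let (_ , _ , _ , _ , trans , _) = ordered in trans _ _ _

    ≤-antisym : x ≤ y → y ≤ x → x ≡ y
    ≤-antisym = let (_ , _ , _ , _ , _ , antisym , _) = ordered in antisym _ _

    ≤-total : ∀ x y → x ≤ y ⊎ y ≤ x
    ≤-total = let (_ , _ , _ , _ , _ , _ , total , _) = ordered in total

    +-monoˡ-≤ : ∀ z → x ≤ y → x + z ≤ y + z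
    +-monoˡ-≤ z = let (_ , _ , _ , _ , _ , _ , _ , mono , _) = ordered in mono _ _ z

    *-nonneg : 0# ≤ x → 0# ≤ y → 0# ≤ x * y
    *-nonneg = let (_ , _ , _ , _ , _ , _ , _ , _ , nonneg) = ordered in nonneg _ _

    ≤-reflexive : x ≡ y → x ≤ y
    ≤-reflexive ≡.refl = ≤-refl

    ≤-poset : Poset Level.zero Level.zero Level.zero
    ≤-poset = record
      { isPartialOrder = record
        { isPreorder = record { isEquivalence = ≡.isEquivalence ; reflexive = ≤-reflexive ; trans = ≤-trans }
        ; antisym    = ≤-antisym
        }
      }

    module ≤-Reasoning = PartialOrderReasoning ≤-poset

    +-monoʳ-≤ : ∀ z → x ≤ y → z + x ≤ z + y
    +-monoʳ-≤ {x} {y} z x≤y = subst₂ _≤_ (+-comm x z) (+-comm y z) (+-monoˡ-≤ z x≤y)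

    +-mono-≤ : x ≤ y → u ≤ v → x + u ≤ y + v
    +-mono-≤ {y = y} {u = u} x≤y u≤v = ≤-trans (+-monoˡ-≤ u x≤y) (+-monoʳ-≤ y u≤v)

    x≤y⇒0≤y-x : x ≤ y → 0# ≤ y - x
    x≤y⇒0≤y-x {x} x≤y = subst (_≤ _) (-‿inverseʳ x) (+-monoˡ-≤ (- x) x≤y)

    0≤y-x⇒x≤y : 0# ≤ y - x → x ≤ y
    0≤y-x⇒x≤y {y} {x} 0≤y-x = subst₂ _≤_ (+-identityˡ x)
      (solve 2 (λ x y → (y :- x) :+ x := y) ≡.refl x y) (+-monoˡ-≤ x 0≤y-x)

    ≤-from-difference : ∀ e → y - x ≡ e → 0# ≤ e → x ≤ y
    ≤-from-difference e y-x≡e 0≤e = 0≤y-x⇒x≤y (subst (0# ≤_) (≡.sym y-x≡e) 0≤e)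

    +-nonneg : 0# ≤ x → 0# ≤ y → 0# ≤ x + y
    +-nonneg 0≤x 0≤y = subst (_≤ _) (+-identityˡ 0#) (+-mono-≤ 0≤x 0≤y)

    neg-mono-≤ : x ≤ y → - y ≤ - x
    neg-mono-≤ {x} {y} x≤y =
      ≤-from-difference (y - x) (solve 2 (λ x y → :- x :- :- y := y :- x) ≡.refl x y) (x≤y⇒0≤y-x x≤y)

    neg-nonpos : 0# ≤ x → - x ≤ 0#
    neg-nonpos 0≤x = subst (_ ≤_) -0#≈0# (neg-mono-≤ 0≤x)

    neg-nonneg : x ≤ 0# → 0# ≤ - x
    neg-nonneg x≤0 = subst (_≤ _) -0#≈0# (neg-mono-≤ x≤0)

    *-monoˡ-≤-nonNeg : 0# ≤ z → x ≤ y → x * z ≤ y * z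
    *-monoˡ-≤-nonNeg {z} {x} {y} 0≤z x≤y =
      ≤-from-difference ((y - x) * z) (solve 3 (λ x y z → y :* z :- x :* z := (y :- x) :* z) ≡.refl x y z)
        (*-nonneg (x≤y⇒0≤y-x x≤y) 0≤z)

    *-monoʳ-≤-nonNeg : 0# ≤ z → x ≤ y → z * x ≤ z * y
    *-monoʳ-≤-nonNeg {z} {x} {y} 0≤z x≤y = subst₂ _≤_ (*-comm x z) (*-comm y z) (*-monoˡ-≤-nonNeg 0≤z x≤y)

    square-nonneg : ∀ x → 0# ≤ x * x
    square-nonneg x with ≤-total 0# x
    ... | inj₁ 0≤x = *-nonneg 0≤x 0≤x
    ... | inj₂ x≤0 = subst (0# ≤_) (solve 1 (λ x → (lit 0 :- x) :* (lit 0 :- x) := x :* x) ≡.refl x)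
                       (*-nonneg (x≤y⇒0≤y-x x≤0) (x≤y⇒0≤y-x x≤0))

    0≤1 : 0# ≤ 1#
    0≤1 = subst (0# ≤_) (*-identityˡ 1#) (square-nonneg 1#)

    1≰0 : ¬ 1# ≤ 0#
    1≰0 1≤0 = 0≢1 (≤-antisym 0≤1 1≤0)

    fromℕ-nonneg : ∀ n → 0# ≤ fromℕ n
    fromℕ-nonneg 0               = ≤-refl
    fromℕ-nonneg 1               = 0≤1
    fromℕ-nonneg (suc n@(suc _)) = +-nonneg (fromℕ-nonneg n) 0≤1

    <⇒≱ : x < y → ¬ y ≤ x
    <⇒≱ (x≤y , x≢y) y≤x = x≢y (≤-antisym x≤y y≤x)

    ≤-<-trans : x ≤ y → y < z → x < z
    ≤-<-trans x≤y (y≤z , y≢z) = ≤-trans x≤y y≤z , λ { ≡.refl → y≢z (≤-antisym y≤z x≤y) }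

    <-≤-trans : x < y → y ≤ z → x < z
    <-≤-trans (x≤y , x≢y) y≤z = ≤-trans x≤y y≤z , λ { ≡.refl → x≢y (≤-antisym x≤y y≤z) }

    <-trans : x < y → y < z → x < z
    <-trans x<y y<z = <-≤-trans x<y (proj₁ y<z)

    0<1 : 0# < 1#
    0<1 = 0≤1 , 0≢1

    1+x-pos : 0# ≤ x → 0# < 1# + x
    1+x-pos {x} 0≤x = <-≤-trans 0<1 (subst (_≤ 1# + x) (+-identityʳ 1#) (+-monoʳ-≤ 1# 0≤x))

    fromℕ-suc-pos : ∀ n → 0# < fromℕ (suc n)
    fromℕ-suc-pos n = subst (0# <_) (≡.sym (fromℕ-suc n)) (1+x-pos (fromℕ-nonneg n))

    x<y⇒0<y-x : x < y → 0# < y - x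
    x<y⇒0<y-x {x} {y} (x≤y , x≢y) = x≤y⇒0≤y-x x≤y , λ 0≡y-x → x≢y (begin
      x            ≡⟨ +-identityʳ x ⟨
      x + 0#       ≡⟨ cong (x +_) 0≡y-x ⟩
      x + (y - x)  ≡⟨ solve 2 (λ x y → x :+ (y :- x) := y) ≡.refl x y ⟩
      y            ∎)
      where open ≡.≡-Reasoning

    0<y-x⇒x<y : 0# < y - x → x < y
    0<y-x⇒x<y (0≤y-x , 0≢y-x) = 0≤y-x⇒x≤y 0≤y-x , λ { ≡.refl → 0≢y-x (≡.sym (-‿inverseʳ _)) }

    x<x+y : 0# < y → x < x + y
    x<x+y {y} {x} 0<y = 0<y-x⇒x<y (subst (0# <_) (solve 2 (λ x y → y := (x :+ y) :- x) ≡.refl x y) 0<y)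

    fromℕ-<-suc : ∀ n → fromℕ n < fromℕ (suc n)
    fromℕ-<-suc n = subst (fromℕ n <_) (≡.trans (+-comm _ 1#) (≡.sym (fromℕ-suc n))) (x<x+y 0<1)

    x-y<x : 0# < y → x - y < x
    x-y<x {y} {x} 0<y = 0<y-x⇒x<y (subst (0# <_) (solve 2 (λ x y → y := x :- (x :- y)) ≡.refl x y) 0<y)

    x-y≤x : 0# ≤ y → x - y ≤ x
    x-y≤x {y} {x} 0≤y = ≤-from-difference y (solve 2 (λ x y → x :- (x :- y) := y) ≡.refl x y) 0≤y

    neg-mono-< : x < y → - y < - x
    neg-mono-< {x} {y} (x≤y , x≢y) = neg-mono-≤ x≤y , λ -y≡-x →
      x≢y (≡.trans (≡.sym (-‿involutive x)) (≡.trans (cong -_ (≡.sym -y≡-x)) (-‿involutive y)))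

    <-glb : x < y → x < z → Σ[ m ∈ M ] x < m × m ≤ y × m ≤ z
    <-glb {y = y} {z} x<y x<z with ≤-total y z
    ... | inj₁ y≤z = y , x<y , ≤-refl , y≤z
    ... | inj₂ z≤y = z , x<z , z≤y , ≤-refl

    <-glb₃ : x < y → x < z → x < u → Σ[ m ∈ M ] x < m × m ≤ y × m ≤ z × m ≤ u
    <-glb₃ x<y x<z x<u with <-glb x<y x<z
    ... | m , x<m , m≤y , m≤z with <-glb x<m x<u
    ... | m′ , x<m′ , m′≤m , m′≤u = m′ , x<m′ , ≤-trans m′≤m m≤y , ≤-trans m′≤m m≤z , m′≤u

    *-inverse-nonneg : 0# ≤ x → x * y ≡ 1# → 0# ≤ y
    *-inverse-nonneg {x} {y} 0≤x xy≡1 with ≤-total 0# y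
    ... | inj₁ 0≤y = 0≤y
    ... | inj₂ y≤0 = ⊥-elim (1≰0 (subst₂ _≤_ xy≡1 (zeroʳ x) (*-monoʳ-≤-nonNeg 0≤x y≤0)))

    *-inverse-cancelʳ : ∀ w → x * y ≡ 1# → w * x * y ≡ w
    *-inverse-cancelʳ {x} {y} w xy≡1 = ≡.trans (*-assoc w x y) (≡.trans (cong (w *_) xy≡1) (*-identityʳ w))

    *-pos : 0# < x → 0# < y → 0# < x * y
    *-pos {x} {y} (0≤x , 0≢x) (0≤y , 0≢y) = *-nonneg 0≤x 0≤y , λ 0≡xy →
      let (x⁻¹ , xx⁻¹≡1) = *-inverse (0≢x ∘ ≡.sym)
      in 0≢y (begin
        0#              ≡⟨ zeroʳ x⁻¹ ⟨
        x⁻¹ * 0#        ≡⟨ cong (x⁻¹ *_) 0≡xy ⟩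
        x⁻¹ * (x * y)   ≡⟨ solve 3 (λ a b c → a :* (b :* c) := c :* b :* a) ≡.refl x⁻¹ x y ⟩
        y * x * x⁻¹     ≡⟨ *-inverse-cancelʳ y xx⁻¹≡1 ⟩
        y               ∎)
      where open ≡.≡-Reasoning

    *-cancelʳ-≤-pos : 0# < z → x * z ≤ y * z → x ≤ y
    *-cancelʳ-≤-pos {z} {x} {y} (0≤z , 0≢z) xz≤yz =
      let (z⁻¹ , zz⁻¹≡1) = *-inverse (0≢z ∘ ≡.sym)
      in subst₂ _≤_ (*-inverse-cancelʳ x zz⁻¹≡1) (*-inverse-cancelʳ y zz⁻¹≡1)
           (*-monoˡ-≤-nonNeg (*-inverse-nonneg 0≤z zz⁻¹≡1) xz≤yz)

    split-≤ : ∀ {A : Set} → Stable A → x ≤ y → (x ≡ y → A) → (x < y → A) → A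
    split-≤ stable x≤y x≡y⇒A x<y⇒A = stable λ ¬A → ¬¬-excluded-middle λ
      { (yes x≡y) → ¬A (x≡y⇒A x≡y)
      ; (no x≢y)  → ¬A (x<y⇒A (x≤y , x≢y)) }

    ¬¬-≤-<-trans : ¬ ¬ x ≤ y → y < z → x ≤ z
    ¬¬-≤-<-trans {x} {y} {z} ¬¬x≤y y<z with ≤-total x z
    ... | inj₁ x≤z = x≤z
    ... | inj₂ z≤x = ⊥-elim (¬¬x≤y λ x≤y → <⇒≱ y<z (≤-trans z≤x x≤y))

    <-¬¬-≤-trans : x < y → ¬ ¬ y ≤ z → x ≤ z
    <-¬¬-≤-trans {x} {y} {z} x<y ¬¬y≤z with ≤-total x z
    ... | inj₁ x≤z = x≤z
    ... | inj₂ z≤x = ⊥-elim (¬¬y≤z λ y≤z → <⇒≱ x<y (≤-trans y≤z z≤x))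

    private
      eighth : Σ[ y ∈ M ] fromℕ 8 * y ≡ 1#
      eighth = *-inverse (proj₂ (fromℕ-suc-pos 7) ∘ ≡.sym)

    ⅛ : M
    ⅛ = proj₁ eighth

    8*⅛≡1 : fromℕ 8 * ⅛ ≡ 1#
    8*⅛≡1 = proj₂ eighth

    ⅛-pos : 0# < ⅛
    ⅛-pos = *-inverse-nonneg (fromℕ-nonneg 8) 8*⅛≡1 , λ 0≡⅛ →
      0≢1 (≡.trans (≡.sym (zeroʳ (fromℕ 8))) (≡.trans (cong (fromℕ 8 *_) 0≡⅛) 8*⅛≡1))

    ⅛*x<x : 0# < x → ⅛ * x < x
    ⅛*x<x {x} 0<x = 0<y-x⇒x<y (subst (0# <_) 7⅛x≡x-⅛x (*-pos (*-pos (fromℕ-suc-pos 6) ⅛-pos) 0<x))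
      where
      open ≡.≡-Reasoning
      7⅛x≡x-⅛x : fromℕ 7 * ⅛ * x ≡ x - ⅛ * x
      7⅛x≡x-⅛x = begin
        fromℕ 7 * ⅛ * x
          ≡⟨ solve 2 (λ e x → lit 7 :* e :* x := lit 8 :* e :* x :- e :* x) ≡.refl ⅛ x ⟩
        fromℕ 8 * ⅛ * x - ⅛ * x
          ≡⟨ cong (λ e → e * x - ⅛ * x) 8*⅛≡1 ⟩
        1# * x - ⅛ * x
          ≡⟨ cong (_- ⅛ * x) (*-identityˡ x) ⟩
        x - ⅛ * x
          ∎

    ⅛<1 : ⅛ < 1#
    ⅛<1 = subst (_< 1#) (*-identityʳ ⅛) (⅛*x<x 0<1)

    1-8⅛≡0 : 1# - fromℕ 8 * ⅛ ≡ 0#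
    1-8⅛≡0 = ≡.trans (cong (λ y → 1# - y) 8*⅛≡1) (-‿inverseʳ 1#)

    -- The solver does not know 8 * ⅛ = 1, so identities involving ⅛ carry an
    -- extra summand (1 - 8 * ⅛) * x, which vanishes.
    [1-8⅛]*x-nonneg : ∀ x → 0# ≤ (1# - fromℕ 8 * ⅛) * x
    [1-8⅛]*x-nonneg x = ≤-reflexive (≡.sym (≡.trans (cong (_* x) 1-8⅛≡0) (zeroˡ x)))

    1±sign*x-pos : ∀ s → 0# ≤ x → x < 1# → 0# < 1# + fromSign s * x × 0# < 1# - fromSign s * x
    1±sign*x-pos {x} Sign.+ 0≤x x<1 =
      subst (λ y → 0# < 1# + y × 0# < 1# - y) (≡.sym (*-identityˡ x)) (1+x-pos 0≤x , x<y⇒0<y-x x<1)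
    1±sign*x-pos {x} Sign.- 0≤x x<1 =
      subst (λ y → 0# < 1# + y × 0# < 1# - y) (≡.sym (-1*x≈-x x))
        (x<y⇒0<y-x x<1 , subst (λ y → 0# < 1# + y) (≡.sym (-‿involutive x)) (1+x-pos 0≤x))

    infix 4 ∣_∣≤_
    ∣_∣≤_ : M → M → Set
    ∣ x ∣≤ y = - y ≤ x × x ≤ y

    ∣∣≤-weaken : ∣ x ∣≤ y → y ≤ z → ∣ x ∣≤ z
    ∣∣≤-weaken (-y≤x , x≤y) y≤z = ≤-trans (neg-mono-≤ y≤z) -y≤x , ≤-trans x≤y y≤z

    ∣∣≤-+ : ∣ x ∣≤ y → ∣ z ∣≤ u → ∣ x + z ∣≤ y + u
    ∣∣≤-+ {y = y} {u = u} (-y≤x , x≤y) (-u≤z , z≤u) =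
      subst (_≤ _) (-‿+-comm y u) (+-mono-≤ -y≤x -u≤z) , +-mono-≤ x≤y z≤u

    ∣∣≤-*-nonneg : 0# ≤ z → ∣ x ∣≤ y → ∣ z * x ∣≤ z * y
    ∣∣≤-*-nonneg {z} {x} {y} 0≤z (-y≤x , x≤y) =
      subst (_≤ z * x) (≡.sym (-‿distribʳ-* z y)) (*-monoʳ-≤-nonNeg 0≤z -y≤x) , *-monoʳ-≤-nonNeg 0≤z x≤y

    ∣∣≤-neg : ∣ x ∣≤ y → ∣ - x ∣≤ y
    ∣∣≤-neg {x} {y} (-y≤x , x≤y) = neg-mono-≤ x≤y , subst (- x ≤_) (-‿involutive y) (neg-mono-≤ -y≤x)

    AbsLt⇒∣sign*∣≤ : ∀ s → AbsLt x y → ∣ fromSign s * x ∣≤ y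
    AbsLt⇒∣sign*∣≤ {x} Sign.+ ((-y≤x , _) , (x≤y , _)) =
      subst (λ z → ∣ z ∣≤ _) (≡.sym (*-identityˡ x)) (-y≤x , x≤y)
    AbsLt⇒∣sign*∣≤ {x} {y} Sign.- ((-y≤x , _) , (x≤y , _)) =
      subst (λ z → ∣ z ∣≤ y) (≡.sym (-1*x≈-x x))
        (neg-mono-≤ x≤y , subst (- x ≤_) (-‿involutive y) (neg-mono-≤ -y≤x))

  module ContinuousInduction (ordered : IsOrderedField) where
    open OrderedFieldProperties ordered

    HoldsOn : (M → Set) → M → Set
    HoldsOn Q t = ∀ u → 0# ≤ u → u ≤ t → Q u

    continuousInduction :
      (Q : M → Set) → (∀ u → Stable (Q u)) → ∀ b → 0# ≤ b →
      Σ M (IsSupremum (λ t → t ≤ b × HoldsOn Q t)) →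
      Q 0# →
      (∀ t → 0# < t → t ≤ b → (∀ u → 0# ≤ u → u < t → Q u) → Q t) →
      (∀ t → 0# ≤ t → t < b → HoldsOn Q t →
             Σ[ δ ∈ M ] 0# < δ × (∀ u → t < u → u ≤ t + δ → Q u)) →
      Q b
    continuousInduction Q stable b 0≤b (s , s-upper , s-least) Q0 leftStep rightStep =
      split-≤ (stable b) s≤b (λ s≡b → subst Q s≡b Q-at-s) (⊥-elim ∘ s≮b)
      where
      0≤s : 0# ≤ s
      0≤s = s-upper 0# (0≤b , λ u 0≤u u≤0 → subst Q (≤-antisym 0≤u u≤0) Q0)

      s≤b : s ≤ b
      s≤b = s-least b (λ _ → proj₁)

      Q-below-s : ∀ u → 0# ≤ u → u < s → Q u
      Q-below-s u 0≤u (u≤s , u≢s) = stable u λ ¬Qu → u≢s (≤-antisym u≤s (s-least u λ t (_ , Q-upto-t) →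
        [ (λ u≤t → contradiction (Q-upto-t u 0≤u u≤t) ¬Qu) , id ]′ (≤-total u t)))

      Q-at-s : Q s
      Q-at-s = split-≤ (stable s) 0≤s (λ 0≡s → subst Q 0≡s Q0) (λ 0<s → leftStep s 0<s s≤b Q-below-s)

      Q-upto-s : HoldsOn Q s
      Q-upto-s u 0≤u u≤s = split-≤ (stable u) u≤s (λ u≡s → subst Q (≡.sym u≡s) Q-at-s) (Q-below-s u 0≤u)

      s≮b : ¬ s < b
      s≮b s<b with rightStep s 0≤s s<b Q-upto-s
      ... | δ , 0<δ , Q-right-of-s with <-glb (x<x+y 0<δ) s<b
      ... | t , s<t , t≤s+δ , t≤b = <⇒≱ s<t (s-upper t (t≤b , Q-upto-t))
        where
        Q-upto-t : HoldsOn Q t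
        Q-upto-t u 0≤u u≤t =
          [ Q-upto-s u 0≤u
          , (λ s≤u → split-≤ (stable u) s≤u (λ s≡u → subst Q s≡u Q-at-s)
                       (λ s<u → Q-right-of-s u s<u (≤-trans u≤t t≤s+δ)))
          ]′ (≤-total u s)

    evalT-renameTerm : ∀ {m n} (r : Fin m → Fin n) (t : Term m) {ρ : Fin n → M} {σ : Fin m → M} →
                       (∀ i → ρ (r i) ≡ σ i) → evalT (renameTerm r t) ρ ≡ evalT t σ
    evalT-renameTerm r (var i)    eq = eq i
    evalT-renameTerm r zer        eq = ≡.refl
    evalT-renameTerm r one        eq = ≡.refl
    evalT-renameTerm r (plus s t) eq = cong₂ _+_ (evalT-renameTerm r s eq) (evalT-renameTerm r t eq)
    evalT-renameTerm r (mult s t) eq = cong₂ _*_ (evalT-renameTerm r s eq) (evalT-renameTerm r t eq)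
    evalT-renameTerm r (tex t)    eq = cong texp (evalT-renameTerm r t eq)

    Defines : ∀ {k} → Term (suc k) → (Fin k → M) → (M → M) → Set
    Defines t ρ f = ∀ u → evalT t (u ∷ ρ) ≡ f u

    private
      skip₂ : ∀ {k} → Term (suc k) → Term (suc (suc (suc k)))
      skip₂ = renameTerm (lift 1 (2 ↑ʳ_))

      evalT-skip₂ : ∀ {k} (t : Term (suc k)) {ρ f} → Defines t ρ f →
                    ∀ u v w → evalT (skip₂ t) (u ∷ v ∷ w ∷ ρ) ≡ f u
      evalT-skip₂ t t≗f u v w = ≡.trans (evalT-renameTerm _ t λ { zero → ≡.refl ; (suc i) → ≡.refl }) (t≗f u)

    -- Read in the context t ∷ b ∷ ρ:  t ≤ b ∧ ∀ u. 0 ≤ u → u ≤ t → ¬¬ (L u ≤ R u).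
    segmentFormula : ∀ {k} → Term (suc k) → Term (suc k) → Formula (suc (suc k))
    segmentFormula L R =
      andF (leF (var zero) (var (suc zero)))
           (allF (impF (leF zer (var zero)) (impF (leF (var zero) (var (suc zero)))
             (impF (impF (leF (skip₂ L) (skip₂ R)) botF) botF))))

    module _ (complete : DefinablyComplete) {k} {f g : M → M} (L R : Term (suc k)) (ρ : Fin k → M)
             (L≗f : Defines L ρ f) (R≗g : Defines R ρ g) (b : M) where

      private
        Segment : M → Set
        Segment t = t ≤ b × HoldsOn (λ u → ¬ ¬ f u ≤ g u) t

        toFormula : ∀ {t} → Segment t → DefSet (segmentFormula L R) (b ∷ ρ) t
        toFormula {t} (t≤b , f≤g) = t≤b , λ u 0≤u u≤t ¬L≤R → f≤g u 0≤u u≤t λ fu≤gu →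
          ¬L≤R (subst₂ _≤_ (≡.sym (evalT-skip₂ L L≗f u t b)) (≡.sym (evalT-skip₂ R R≗g u t b)) fu≤gu)

        fromFormula : ∀ {t} → DefSet (segmentFormula L R) (b ∷ ρ) t → Segment t
        fromFormula {t} (t≤b , L≤R) = t≤b , λ u 0≤u u≤t ¬f≤g → L≤R u 0≤u u≤t λ Lu≤Ru →
          ¬f≤g (subst₂ _≤_ (evalT-skip₂ L L≗f u t b) (evalT-skip₂ R R≗g u t b) Lu≤Ru)

      segment-hasSupremum : 0# ≤ b → f 0# ≤ g 0# → Σ M (IsSupremum Segment)
      segment-hasSupremum 0≤b f0≤g0 =
        let (s , s-upper , s-least) = complete (segmentFormula L R) (b ∷ ρ)
                                        (0# , toFormula (0≤b , f≤g-at-0)) (b , λ _ → proj₁)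
        in s , (λ t → s-upper t ∘ toFormula) , λ c c-upper → s-least c (λ t → c-upper t ∘ fromFormula)
        where
        f≤g-at-0 : HoldsOn (λ u → ¬ ¬ f u ≤ g u) 0#
        f≤g-at-0 u 0≤u u≤0 = pure (subst (λ v → f v ≤ g v) (≤-antisym 0≤u u≤0) f0≤g0)

  module EulerComparison (ordered : IsOrderedField) where
    open OrderedFieldProperties ordered
    open ContinuousInduction ordered

    -- A subsolution follows the forward and backward Euler steps of f′ = σ f up to
    -- o(h); a strict supersolution beats them by a fixed margin ε h.
    IsEulerSubsolution : Sign → (M → M) → M → Set
    IsEulerSubsolution σ f b =
      ∀ t → 0# ≤ t → t ≤ b → ∀ ε → 0# < ε → Σ[ δ ∈ M ] 0# < δ × (∀ h → 0# < h → h ≤ δ →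
        f (t + h) ≤ f t * (1# + fromSign σ * h) + ε * h × f t * (1# - fromSign σ * h) ≤ f (t - h) + ε * h)

    IsStrictEulerSupersolutionʳ : Sign → (M → M) → M → Set
    IsStrictEulerSupersolutionʳ σ g b = ∀ t → 0# ≤ t → t < b → Σ[ ε ∈ M ] 0# < ε × Σ[ η ∈ M ] 0# < η ×
      (∀ h → 0# < h → h ≤ η → g t * (1# + fromSign σ * h) + ε * h ≤ g (t + h))

    IsStrictEulerSupersolutionˡ : Sign → (M → M) → M → Set
    IsStrictEulerSupersolutionˡ σ g b = ∀ t → 0# < t → t ≤ b → Σ[ ε ∈ M ] 0# < ε × Σ[ η ∈ M ] 0# < η ×
      (∀ h → 0# < h → h ≤ η → g (t - h) + ε * h ≤ g t * (1# - fromSign σ * h))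

    IsStrictEulerSupersolution : Sign → (M → M) → M → Set
    IsStrictEulerSupersolution σ g b = IsStrictEulerSupersolutionʳ σ g b × IsStrictEulerSupersolutionˡ σ g b

    -- The margin of g absorbs the o(h) error of f, on either side of a point.
    comparison :
      DefinablyComplete → ∀ σ {k} {f g : M → M} (L R : Term (suc k)) (ρ : Fin k → M) →
      Defines L ρ f → Defines R ρ g → ∀ b → 0# ≤ b → b < 1# → f 0# ≤ g 0# →
      IsEulerSubsolution σ f b → IsStrictEulerSupersolution σ g b → ¬ ¬ f b ≤ g b
    comparison complete σ {f = f} {g} L R ρ L≗f R≗g b 0≤b b<1 f0≤g0 f-sub (g-superʳ , g-superˡ) =
      continuousInduction (λ u → ¬ ¬ f u ≤ g u) (λ _ → negated-stable) b 0≤b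
        (segment-hasSupremum complete L R ρ L≗f R≗g b 0≤b f0≤g0) (pure f0≤g0) leftStep rightStep
      where
      1±σh-pos : ∀ {h} → 0# ≤ h → h ≤ b → 0# < 1# + fromSign σ * h × 0# < 1# - fromSign σ * h
      1±σh-pos 0≤h h≤b = 1±sign*x-pos σ 0≤h (≤-<-trans h≤b b<1)

      rightStep : ∀ t → 0# ≤ t → t < b → HoldsOn (λ u → ¬ ¬ f u ≤ g u) t →
                  Σ[ δ ∈ M ] 0# < δ × (∀ u → t < u → u ≤ t + δ → ¬ ¬ f u ≤ g u)
      rightStep t 0≤t t<b f≤g-upto-t with g-superʳ t 0≤t t<b
      ... | ε , 0<ε , η , 0<η , g-step with f-sub t 0≤t (proj₁ t<b) ε 0<ε
      ... | δ , 0<δ , f-step with <-glb₃ 0<η 0<δ (x<y⇒0<y-x t<b)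
      ... | d , 0<d , d≤η , d≤δ , d≤b-t = d , 0<d , λ u t<u u≤t+d →
        subst (λ v → ¬ ¬ f v ≤ g v) (solve 2 (λ t u → t :+ (u :- t) := u) ≡.refl t u)
          (step (u - t) (x<y⇒0<y-x t<u) (≤-trans (+-monoˡ-≤ (- t) u≤t+d)
                                            (≤-reflexive (solve 2 (λ t d → t :+ d :- t := d) ≡.refl t d))))
        where
        step : ∀ h → 0# < h → h ≤ d → ¬ ¬ f (t + h) ≤ g (t + h)
        step h 0<h h≤d = do
          ft≤gt ← f≤g-upto-t t 0≤t ≤-refl
          let 0≤1+σh = proj₁ (proj₁ (1±σh-pos (proj₁ 0<h) (≤-trans h≤d (≤-trans d≤b-t (x-y≤x 0≤t)))))
          pure (≤-trans (proj₁ (f-step h 0<h (≤-trans h≤d d≤δ)))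
                 (≤-trans (+-monoˡ-≤ (ε * h) (*-monoˡ-≤-nonNeg 0≤1+σh ft≤gt))
                   (g-step h 0<h (≤-trans h≤d d≤η))))

      leftStep : ∀ t → 0# < t → t ≤ b → (∀ u → 0# ≤ u → u < t → ¬ ¬ f u ≤ g u) → ¬ ¬ f t ≤ g t
      leftStep t 0<t t≤b f≤g-below-t with g-superˡ t 0<t t≤b
      ... | ε , 0<ε , η , 0<η , g-step with f-sub t (proj₁ 0<t) t≤b ε 0<ε
      ... | δ , 0<δ , f-step with <-glb₃ 0<η 0<δ 0<t
      ... | d , 0<d , d≤η , d≤δ , d≤t = do
        f≤g-at-t-d ← f≤g-below-t (t - d) (x≤y⇒0≤y-x d≤t) (x-y<x 0<d)
        let 0<1-σd = proj₂ (1±σh-pos (proj₁ 0<d) (≤-trans d≤t t≤b))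
        pure (*-cancelʳ-≤-pos 0<1-σd
               (≤-trans (proj₂ (f-step d 0<d d≤δ))
                 (≤-trans (+-monoˡ-≤ (ε * d) f≤g-at-t-d) (g-step d 0<d d≤η))))

  module TexpDerivative (ordered : IsOrderedField) (derivative : TexpDerivativeAxiom) where
    open OrderedFieldProperties ordered
    open EulerComparison ordered

    private
      variable
        t : M

    fromSign-opposite : ∀ s → fromSign (Sign.opposite s) ≡ - fromSign s
    fromSign-opposite Sign.+ = ≡.refl
    fromSign-opposite Sign.- = ≡.sym (-‿involutive 1#)

    sign*-inUnitInterval : ∀ s → 0# ≤ t → t < 1# → InUnitInterval (fromSign s * t)
    sign*-inUnitInterval {t} Sign.+ 0≤t t<1 =
      subst InUnitInterval (≡.sym (*-identityˡ t)) (<-≤-trans -1<0 0≤t , t<1)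
      where
      -1<0 : - 1# < 0#
      -1<0 = subst (- 1# <_) -0#≈0# (neg-mono-< 0<1)
    sign*-inUnitInterval {t} Sign.- 0≤t t<1 =
      subst InUnitInterval (≡.sym (-1*x≈-x t)) (neg-mono-< t<1 , ≤-<-trans (neg-nonpos 0≤t) 0<1)

    -- ⅛ δ turns the strict bound h < δ of the axiom into a non-strict one.
    texp-linearisation : ∀ x → InUnitInterval x → ∀ ε → 0# < ε → Σ[ δ ∈ M ] 0# < δ ×
      (∀ s h → 0# < h → h ≤ δ → AbsLt (texp (x + fromSign s * h) - texp x - fromSign s * h * texp x) (ε * h))
    texp-linearisation x x∈I ε 0<ε with derivative x x∈I ε 0<ε
    ... | δ , 0<δ , right , left = ⅛ * δ , *-pos ⅛-pos 0<δ , linear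
      where
      Linear : M → M → Set
      Linear η h = AbsLt (texp (x + η) - texp x - η * texp x) (ε * h)

      linear : ∀ s h → 0# < h → h ≤ ⅛ * δ → Linear (fromSign s * h) h
      linear Sign.+ h 0<h h≤⅛δ = subst (λ η → Linear η h) (≡.sym (*-identityˡ h)) (right h 0<h h<δ)
        where h<δ = ≤-<-trans h≤⅛δ (⅛*x<x 0<δ)
      linear Sign.- h 0<h h≤⅛δ = subst₂ Linear (≡.sym (-1*x≈-x h)) (-‿involutive h)
        (left (- h) (neg-mono-< h<δ) (subst (- h <_) -0#≈0# (neg-mono-< 0<h)))
        where h<δ = ≤-<-trans h≤⅛δ (⅛*x<x 0<δ)

    texp-isEulerSubsolution : ∀ c σ b → b < 1# → IsEulerSubsolution σ (λ u → fromSign c * texp (fromSign σ * u)) b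
    texp-isEulerSubsolution c σ b b<1 t 0≤t t≤b ε 0<ε =
      let (δ , 0<δ , linear) = texp-linearisation x (sign*-inUnitInterval σ 0≤t (≤-<-trans t≤b b<1)) ε 0<ε
      in δ , 0<δ , λ h 0<h h≤δ →
        forward h (linear σ h 0<h h≤δ) ,
        backward h (subst (λ e → AbsLt (texp (x + e * h) - texp x - e * h * texp x) (ε * h))
                          (fromSign-opposite σ) (linear (Sign.opposite σ) h 0<h h≤δ))
      where
      open ≤-Reasoning
      ĉ = fromSign c
      σ̂ = fromSign σ
      x = σ̂ * t

      forward : ∀ h → AbsLt (texp (x + σ̂ * h) - texp x - σ̂ * h * texp x) (ε * h) →
                ĉ * texp (σ̂ * (t + h)) ≤ ĉ * texp x * (1# + σ̂ * h) + ε * h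
      forward h lin = begin
        ĉ * texp (σ̂ * (t + h))
          ≡⟨ cong (λ y → ĉ * texp y) (solve 3 (λ s t h → s :* (t :+ h) := s :* t :+ s :* h) ≡.refl σ̂ t h) ⟩
        ĉ * texp (x + σ̂ * h)
          ≡⟨ solve 4 (λ a e T E → a :* T := a :* E :* (lit 1 :+ e) :+ a :* (T :- E :- e :* E)) ≡.refl
                     ĉ (σ̂ * h) (texp (x + σ̂ * h)) (texp x) ⟩
        ĉ * texp x * (1# + σ̂ * h) + ĉ * (texp (x + σ̂ * h) - texp x - σ̂ * h * texp x)
          ≤⟨ +-monoʳ-≤ _ (proj₂ (AbsLt⇒∣sign*∣≤ c lin)) ⟩
        ĉ * texp x * (1# + σ̂ * h) + ε * h
          ∎

      backward : ∀ h → AbsLt (texp (x + - σ̂ * h) - texp x - - σ̂ * h * texp x) (ε * h) →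
                 ĉ * texp x * (1# - σ̂ * h) ≤ ĉ * texp (σ̂ * (t - h)) + ε * h
      backward h lin = begin
        ĉ * texp x * (1# - σ̂ * h)
          ≡⟨ solve 5 (λ a s h T E → a :* E :* (lit 1 :- s :* h) := a :* T :- a :* (T :- E :- :- s :* h :* E)) ≡.refl
                     ĉ σ̂ h (texp (x + - σ̂ * h)) (texp x) ⟩
        ĉ * texp (x + - σ̂ * h) - ĉ * (texp (x + - σ̂ * h) - texp x - - σ̂ * h * texp x)
          ≤⟨ +-monoʳ-≤ _ (neg-mono-≤ (proj₁ (AbsLt⇒∣sign*∣≤ c lin))) ⟩
        ĉ * texp (x + - σ̂ * h) - - (ε * h)
          ≡⟨ cong₂ (λ y z → ĉ * texp y + z)
                   (solve 3 (λ s t h → s :* t :+ :- s :* h := s :* (t :- h)) ≡.refl σ̂ t h) (-‿involutive (ε * h)) ⟩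
        ĉ * texp (σ̂ * (t - h)) + ε * h
          ∎

  module TexpEstimates (ordered : IsOrderedField) (complete : DefinablyComplete)
                       (derivative : TexpDerivativeAxiom) (texp-0 : texp 0# ≡ 1#) where
    open OrderedFieldProperties ordered
    open ContinuousInduction ordered using (Defines)
    open EulerComparison ordered
    open TexpDerivative ordered derivative using (texp-isEulerSubsolution)

    texp-comparison :
      ∀ c σ {k} (R : Term (suc (suc (suc k)))) (ρ : Fin k → M) {g : M → M} →
      Defines R (fromSign c ∷ fromSign σ ∷ ρ) g → ∀ b → 0# ≤ b → b < 1# → fromSign c ≤ g 0# →
      IsStrictEulerSupersolution σ g b → ¬ ¬ fromSign c * texp (fromSign σ * b) ≤ g b
    texp-comparison c σ {k} R ρ {g} R≗g b 0≤b b<1 c≤g0 =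
      comparison complete σ cTexpσᵀ R (fromSign c ∷ fromSign σ ∷ ρ) cTexpσᵀ≗ R≗g b 0≤b b<1 f0≤g0
        (texp-isEulerSubsolution c σ b b<1)
      where
      cTexpσᵀ : Term (suc (suc (suc k)))
      cTexpσᵀ = mult (var (suc zero)) (tex (mult (var (suc (suc zero))) (var zero)))

      cTexpσᵀ≗ : Defines cTexpσᵀ (fromSign c ∷ fromSign σ ∷ ρ) (λ u → fromSign c * texp (fromSign σ * u))
      cTexpσᵀ≗ _ = ≡.refl

      f0≤g0 : fromSign c * texp (fromSign σ * 0#) ≤ g 0#
      f0≤g0 = subst (_≤ g 0#) (≡.sym (≡.trans (cong (λ y → fromSign c * texp y) (zeroʳ (fromSign σ)))
                                      (≡.trans (cong (fromSign c *_) texp-0) (*-identityʳ (fromSign c)))))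
                    c≤g0

    private
      variable
        x : M

    upperQuadratic : M → M
    upperQuadratic u = 1# + fromℕ 2 * u + fromℕ 2 * (u * u)

    upperQuadraticᴾ : ∀ {n} → Polynomial n → Polynomial n
    upperQuadraticᴾ u = lit 1 :+ lit 2 :* u :+ lit 2 :* (u :* u)

    upperQuadratic-isStrictEulerSupersolution : ∀ b → b < 1# → IsStrictEulerSupersolution Sign.+ upperQuadratic b
    upperQuadratic-isStrictEulerSupersolution b b<1 = right , left
      where
      right : IsStrictEulerSupersolutionʳ Sign.+ upperQuadratic b
      right t 0≤t t<b = 1# , 0<1 , 1# , 0<1 , λ h 0<h _ →
        ≤-from-difference (fromℕ 2 * h * (t * (1# - t)) + fromℕ 2 * (h * h))
          (solve 2 (λ t h → upperQuadraticᴾ (t :+ h) :- (upperQuadraticᴾ t :* (lit 1 :+ lit 1 :* h) :+ lit 1 :* h)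
                            := lit 2 :* h :* (t :* (lit 1 :- t)) :+ lit 2 :* (h :* h)) ≡.refl t h)
          (+-nonneg (*-nonneg (*-nonneg (fromℕ-nonneg 2) (proj₁ 0<h))
                              (*-nonneg 0≤t (x≤y⇒0≤y-x (proj₁ (<-trans t<b b<1)))))
                    (*-nonneg (fromℕ-nonneg 2) (square-nonneg h)))
      left : IsStrictEulerSupersolutionˡ Sign.+ upperQuadratic b
      left t 0<t t≤b =
        fromℕ 4 * ⅛ , *-pos (fromℕ-suc-pos 3) ⅛-pos , fromℕ 2 * ⅛ , *-pos (fromℕ-suc-pos 1) ⅛-pos , λ h 0<h h≤2⅛ →
        ≤-from-difference
          ((1# - fromℕ 8 * ⅛) * h + fromℕ 2 * h * (fromℕ 2 * ⅛ - h) + fromℕ 2 * h * (t * (1# - t)))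
          (solve 3 (λ t h e → upperQuadraticᴾ t :* (lit 1 :- lit 1 :* h) :- (upperQuadraticᴾ (t :- h) :+ lit 4 :* e :* h)
                              := (lit 1 :- lit 8 :* e) :* h :+ lit 2 :* h :* (lit 2 :* e :- h)
                                 :+ lit 2 :* h :* (t :* (lit 1 :- t)))
                   ≡.refl t h ⅛)
          (+-nonneg (+-nonneg ([1-8⅛]*x-nonneg h)
                              (*-nonneg (*-nonneg (fromℕ-nonneg 2) (proj₁ 0<h)) (x≤y⇒0≤y-x h≤2⅛)))
                    (*-nonneg (*-nonneg (fromℕ-nonneg 2) (proj₁ 0<h))
                              (*-nonneg (proj₁ 0<t) (x≤y⇒0≤y-x (≤-trans t≤b (proj₁ b<1))))))

    sign-isStrictEulerSupersolution : ∀ c b → IsStrictEulerSupersolution (Sign.opposite c) (λ _ → fromSign c) b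
    sign-isStrictEulerSupersolution c b =
      (λ _ _ _ → 1# , 0<1 , 1# , 0<1 , λ h _ _ → ≤-reflexive (right c h)) ,
      (λ _ _ _ → 1# , 0<1 , 1# , 0<1 , λ h _ _ → ≤-reflexive (left c h))
      where
      right : ∀ c h → fromSign c * (1# + fromSign (Sign.opposite c) * h) + 1# * h ≡ fromSign c
      right Sign.+ = solve 1 (λ h → lit 1 :* (lit 1 :+ :- lit 1 :* h) :+ lit 1 :* h := lit 1) ≡.refl
      right Sign.- = solve 1 (λ h → :- lit 1 :* (lit 1 :+ lit 1 :* h) :+ lit 1 :* h := :- lit 1) ≡.refl
      left : ∀ c h → fromSign c + 1# * h ≡ fromSign c * (1# - fromSign (Sign.opposite c) * h)
      left Sign.+ = solve 1 (λ h → lit 1 :+ lit 1 :* h := lit 1 :* (lit 1 :- :- lit 1 :* h)) ≡.refl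
      left Sign.- = solve 1 (λ h → :- lit 1 :+ lit 1 :* h := :- lit 1 :* (lit 1 :- lit 1 :* h)) ≡.refl

    lowerQuadratic : M → M
    lowerQuadratic u = ⅛ * (fromℕ 8 - fromℕ 12 * u + fromℕ 5 * (u * u))

    lowerQuadraticᴾ : ∀ {n} → Polynomial n → Polynomial n → Polynomial n
    lowerQuadraticᴾ e u = e :* (lit 8 :- lit 12 :* u :+ lit 5 :* (u :* u))

    -lowerQuadratic-isStrictEulerSupersolution :
      ∀ b → b < 1# → IsStrictEulerSupersolution Sign.- (λ u → - lowerQuadratic u) b
    -lowerQuadratic-isStrictEulerSupersolution b b<1 = right , left
      where
      0≤⅛h : ∀ {h} → 0# < h → 0# ≤ ⅛ * h
      0≤⅛h 0<h = *-nonneg (proj₁ ⅛-pos) (proj₁ 0<h)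

      0≤[3+5t][1-t] : ∀ {t} → 0# ≤ t → t ≤ b → 0# ≤ (fromℕ 3 + fromℕ 5 * t) * (1# - t)
      0≤[3+5t][1-t] 0≤t t≤b = *-nonneg (+-nonneg (fromℕ-nonneg 3) (*-nonneg (fromℕ-nonneg 5) 0≤t))
                                       (x≤y⇒0≤y-x (≤-trans t≤b (proj₁ b<1)))

      right : IsStrictEulerSupersolutionʳ Sign.- (λ u → - lowerQuadratic u) b
      right t 0≤t t<b = ⅛ * ⅛ , *-pos ⅛-pos ⅛-pos , ⅛ , ⅛-pos , λ h 0<h h≤⅛ →
        ≤-from-difference
          (⅛ * h * ((fromℕ 3 + fromℕ 5 * t) * (1# - t)) + (1# - fromℕ 8 * ⅛) * (⅛ * h)
            + ⅛ * h * (fromℕ 2 * ⅛) + ⅛ * h * (fromℕ 5 * (⅛ - h)))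
          (solve 3 (λ t h e → :- lowerQuadraticᴾ e (t :+ h)
                                :- (:- lowerQuadraticᴾ e t :* (lit 1 :+ :- lit 1 :* h) :+ e :* e :* h)
                              := e :* h :* ((lit 3 :+ lit 5 :* t) :* (lit 1 :- t)) :+ (lit 1 :- lit 8 :* e) :* (e :* h)
                                 :+ e :* h :* (lit 2 :* e) :+ e :* h :* (lit 5 :* (e :- h)))
                   ≡.refl t h ⅛)
          (+-nonneg (+-nonneg (+-nonneg (*-nonneg (0≤⅛h 0<h) (0≤[3+5t][1-t] 0≤t (proj₁ t<b)))
                                        ([1-8⅛]*x-nonneg (⅛ * h)))
                              (*-nonneg (0≤⅛h 0<h) (*-nonneg (fromℕ-nonneg 2) (proj₁ ⅛-pos))))
                    (*-nonneg (0≤⅛h 0<h) (*-nonneg (fromℕ-nonneg 5) (x≤y⇒0≤y-x h≤⅛))))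

      left : IsStrictEulerSupersolutionˡ Sign.- (λ u → - lowerQuadratic u) b
      left t 0<t t≤b = ⅛ * ⅛ , *-pos ⅛-pos ⅛-pos , ⅛ , ⅛-pos , λ h 0<h h≤⅛ →
        ≤-from-difference
          (⅛ * h * ((fromℕ 3 + fromℕ 5 * t) * (1# - t)) + (1# - fromℕ 8 * ⅛) * (⅛ * h)
            + ⅛ * h * (fromℕ 2 * ⅛) + ⅛ * h * (fromℕ 5 * (⅛ + h)))
          (solve 3 (λ t h e → :- lowerQuadraticᴾ e t :* (lit 1 :- :- lit 1 :* h)
                                :- (:- lowerQuadraticᴾ e (t :- h) :+ e :* e :* h)
                              := e :* h :* ((lit 3 :+ lit 5 :* t) :* (lit 1 :- t)) :+ (lit 1 :- lit 8 :* e) :* (e :* h)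
                                 :+ e :* h :* (lit 2 :* e) :+ e :* h :* (lit 5 :* (e :+ h)))
                   ≡.refl t h ⅛)
          (+-nonneg (+-nonneg (+-nonneg (*-nonneg (0≤⅛h 0<h) (0≤[3+5t][1-t] (proj₁ 0<t) t≤b))
                                        ([1-8⅛]*x-nonneg (⅛ * h)))
                              (*-nonneg (0≤⅛h 0<h) (*-nonneg (fromℕ-nonneg 2) (proj₁ ⅛-pos))))
                    (*-nonneg (0≤⅛h 0<h) (*-nonneg (fromℕ-nonneg 5) (+-nonneg (proj₁ ⅛-pos) (proj₁ 0<h)))))

    private
      -[-1*y]≡y : ∀ y → - (- 1# * y) ≡ y
      -[-1*y]≡y y = ≡.trans (cong -_ (-1*x≈-x y)) (-‿involutive y)

    texp≤upperQuadratic : 0# ≤ x → x < 1# → ¬ ¬ texp x ≤ upperQuadratic x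
    texp≤upperQuadratic {x} 0≤x x<1 =
      subst (_≤ upperQuadratic x) (≡.trans (*-identityˡ _) (cong texp (*-identityˡ x))) <$>
        texp-comparison Sign.+ Sign.+ upperQuadraticᵀ [] (λ _ → ≡.refl) x 0≤x x<1
          (≤-reflexive (solve 0 (lit 1 := upperQuadraticᴾ (lit 0)) ≡.refl))
          (upperQuadratic-isStrictEulerSupersolution x x<1)
      where
      upperQuadraticᵀ : Term 3
      upperQuadraticᵀ = plus (plus one (mult (numeral 2) (var zero))) (mult (numeral 2) (mult (var zero) (var zero)))

    1≤texp : 0# ≤ x → x < 1# → ¬ ¬ 1# ≤ texp x
    1≤texp {x} 0≤x x<1 =
      (λ -texp≤-1 → subst₂ _≤_ (-‿involutive 1#) (≡.trans (-[-1*y]≡y _) (cong texp (*-identityˡ x)))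
                      (neg-mono-≤ -texp≤-1)) <$>
        texp-comparison Sign.- Sign.+ (var (suc zero)) [] (λ _ → ≡.refl) x 0≤x x<1 ≤-refl
          (sign-isStrictEulerSupersolution Sign.- x)

    texp[-x]≤1 : 0# ≤ x → x < 1# → ¬ ¬ texp (- x) ≤ 1#
    texp[-x]≤1 {x} 0≤x x<1 =
      subst (_≤ 1#) (≡.trans (*-identityˡ _) (cong texp (-1*x≈-x x))) <$>
        texp-comparison Sign.+ Sign.- (var (suc zero)) [] (λ _ → ≡.refl) x 0≤x x<1 ≤-refl
          (sign-isStrictEulerSupersolution Sign.+ x)

    lowerQuadratic≤texp[-x] : 0# ≤ x → x < 1# → ¬ ¬ lowerQuadratic x ≤ texp (- x)
    lowerQuadratic≤texp[-x] {x} 0≤x x<1 =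
      (λ -texp≤-q → subst₂ _≤_ (-‿involutive _) (≡.trans (-[-1*y]≡y _) (cong texp (-1*x≈-x x)))
                      (neg-mono-≤ -texp≤-q)) <$>
        texp-comparison Sign.- Sign.- -lowerQuadraticᵀ (⅛ ∷ []) -lowerQuadratic≗ x 0≤x x<1
          (≤-reflexive (cong -_ (≡.sym lowerQuadratic0≡1)))
          (-lowerQuadratic-isStrictEulerSupersolution x x<1)
      where
      -lowerQuadraticᵀ : Term 4
      -lowerQuadraticᵀ =
        mult (var (suc zero)) (mult (var (suc (suc (suc zero))))
          (plus (plus (numeral 8) (mult (var (suc (suc zero))) (mult (numeral 12) (var zero))))
                (mult (numeral 5) (mult (var zero) (var zero)))))

      -lowerQuadratic≗ : Defines -lowerQuadraticᵀ (- 1# ∷ - 1# ∷ ⅛ ∷ []) (λ u → - lowerQuadratic u)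
      -lowerQuadratic≗ u =
        solve 2 (λ u e → :- lit 1 :* (e :* (lit 8 :+ :- lit 1 :* (lit 12 :* u) :+ lit 5 :* (u :* u)))
                         := :- lowerQuadraticᴾ e u) ≡.refl u ⅛

      lowerQuadratic0≡1 : lowerQuadratic 0# ≡ 1#
      lowerQuadratic0≡1 = ≡.trans (solve 1 (λ e → lowerQuadraticᴾ e (lit 0) := lit 8 :* e) ≡.refl ⅛) 8*⅛≡1

    record TexpBounds (x : M) : Set where
      field
        lower    : ⅛ ≤ texp x
        upper    : texp x ≤ fromℕ 5
        near-one : ∀ m → ∣ x ∣≤ m → ∣ texp x - 1# ∣≤ fromℕ 4 * m

    texp-bounds-nonneg : 0# ≤ x → x < 1# → ¬ ¬ TexpBounds x
    texp-bounds-nonneg {x} 0≤x x<1 = do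
      texp≤q ← texp≤upperQuadratic 0≤x x<1
      1≤texp-x ← 1≤texp 0≤x x<1
      pure record
        { lower    = ≤-trans (proj₁ ⅛<1) 1≤texp-x
        ; upper    = ≤-trans texp≤q q≤5
        ; near-one = λ m ∣x∣≤m →
            ∣∣≤-weaken (∣texp-1∣≤4x texp≤q 1≤texp-x) (*-monoʳ-≤-nonNeg (fromℕ-nonneg 4) (proj₂ ∣x∣≤m))
        }
      where
      0≤1-x : 0# ≤ 1# - x
      0≤1-x = x≤y⇒0≤y-x (proj₁ x<1)

      0≤4x : 0# ≤ fromℕ 4 * x
      0≤4x = *-nonneg (fromℕ-nonneg 4) 0≤x

      q≤5 : upperQuadratic x ≤ fromℕ 5
      q≤5 = ≤-from-difference (fromℕ 2 * (1# - x) + fromℕ 2 * ((1# - x) * (1# + x)))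
        (solve 1 (λ x → lit 5 :- upperQuadraticᴾ x := lit 2 :* (lit 1 :- x) :+ lit 2 :* ((lit 1 :- x) :* (lit 1 :+ x)))
                 ≡.refl x)
        (+-nonneg (*-nonneg (fromℕ-nonneg 2) 0≤1-x) (*-nonneg (fromℕ-nonneg 2) (*-nonneg 0≤1-x (+-nonneg 0≤1 0≤x))))

      q-1≤4x : upperQuadratic x - 1# ≤ fromℕ 4 * x
      q-1≤4x = ≤-from-difference (fromℕ 2 * x * (1# - x))
        (solve 1 (λ x → lit 4 :* x :- (upperQuadraticᴾ x :- lit 1) := lit 2 :* x :* (lit 1 :- x)) ≡.refl x)
        (*-nonneg (*-nonneg (fromℕ-nonneg 2) 0≤x) 0≤1-x)

      ∣texp-1∣≤4x : texp x ≤ upperQuadratic x → 1# ≤ texp x → ∣ texp x - 1# ∣≤ fromℕ 4 * x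
      ∣texp-1∣≤4x texp≤q 1≤texp-x =
        ≤-trans (neg-nonpos 0≤4x) (x≤y⇒0≤y-x 1≤texp-x) , ≤-trans (+-monoˡ-≤ (- 1#) texp≤q) q-1≤4x

    texp-bounds-neg : 0# ≤ x → x < 1# → ¬ ¬ TexpBounds (- x)
    texp-bounds-neg {x} 0≤x x<1 = do
      texp≤1 ← texp[-x]≤1 0≤x x<1
      q≤texp ← lowerQuadratic≤texp[-x] 0≤x x<1
      pure record
        { lower    = ≤-trans ⅛≤q q≤texp
        ; upper    = ≤-trans texp≤1 1≤5
        ; near-one = λ m ∣-x∣≤m →
            ∣∣≤-weaken (∣texp-1∣≤4x texp≤1 q≤texp)
              (*-monoʳ-≤-nonNeg (fromℕ-nonneg 4) (subst (_≤ m) (-‿involutive x) (proj₂ (∣∣≤-neg ∣-x∣≤m))))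
        }
      where
      0≤1-x : 0# ≤ 1# - x
      0≤1-x = x≤y⇒0≤y-x (proj₁ x<1)

      0≤4x : 0# ≤ fromℕ 4 * x
      0≤4x = *-nonneg (fromℕ-nonneg 4) 0≤x

      1≤5 : 1# ≤ fromℕ 5
      1≤5 = ≤-from-difference (fromℕ 4) (solve 0 (lit 5 :- lit 1 := lit 4) ≡.refl) (fromℕ-nonneg 4)

      ⅛≤q : ⅛ ≤ lowerQuadratic x
      ⅛≤q = ≤-from-difference (⅛ * ((1# - x) * (fromℕ 2 + fromℕ 5 * (1# - x))))
        (solve 2 (λ e x → lowerQuadraticᴾ e x :- e := e :* ((lit 1 :- x) :* (lit 2 :+ lit 5 :* (lit 1 :- x))))
                 ≡.refl ⅛ x)
        (*-nonneg (proj₁ ⅛-pos) (*-nonneg 0≤1-x (+-nonneg (fromℕ-nonneg 2) (*-nonneg (fromℕ-nonneg 5) 0≤1-x))))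

      -4x≤q-1 : - (fromℕ 4 * x) ≤ lowerQuadratic x - 1#
      -4x≤q-1 = ≤-from-difference
        ((1# - fromℕ 8 * ⅛) * (fromℕ 4 * x - 1#) + fromℕ 20 * ⅛ * x + fromℕ 5 * ⅛ * (x * x))
        (solve 2 (λ e x → lowerQuadraticᴾ e x :- lit 1 :- :- (lit 4 :* x)
                          := (lit 1 :- lit 8 :* e) :* (lit 4 :* x :- lit 1) :+ lit 20 :* e :* x :+ lit 5 :* e :* (x :* x))
               ≡.refl ⅛ x)
        (+-nonneg (+-nonneg ([1-8⅛]*x-nonneg _) (*-nonneg (*-nonneg (fromℕ-nonneg 20) (proj₁ ⅛-pos)) 0≤x))
                  (*-nonneg (*-nonneg (fromℕ-nonneg 5) (proj₁ ⅛-pos)) (square-nonneg x)))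

      ∣texp-1∣≤4x : texp (- x) ≤ 1# → lowerQuadratic x ≤ texp (- x) → ∣ texp (- x) - 1# ∣≤ fromℕ 4 * x
      ∣texp-1∣≤4x texp≤1 q≤texp =
        ≤-trans -4x≤q-1 (+-monoˡ-≤ (- 1#) q≤texp) ,
        ≤-trans (subst (_ ≤_) (-‿inverseʳ 1#) (+-monoˡ-≤ (- 1#) texp≤1)) 0≤4x

    texp-bounds : ∀ x → InUnitInterval x → ¬ ¬ TexpBounds x
    texp-bounds x (-1<x , x<1) = [ (λ 0≤x → texp-bounds-nonneg 0≤x x<1) , nonpos ]′ (≤-total 0# x)
      where
      nonpos : x ≤ 0# → ¬ ¬ TexpBounds x
      nonpos x≤0 = subst TexpBounds (-‿involutive x) <$>
        texp-bounds-neg (neg-nonneg x≤0) (subst (- x <_) (-‿involutive 1#) (neg-mono-< -1<x))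

  module ConvexSubring (ordered : IsOrderedField) (O 𝔪 : M → Set)
                       (convex : IsConvexSubring O) (maximal : IsMaximalIdealOf O 𝔪) where
    open OrderedFieldProperties ordered

    private
      variable
        x y : M

    O-0 : O 0#
    O-0 = let (O-0 , _) = convex in O-0

    O-1 : O 1#
    O-1 = let (_ , O-1 , _) = convex in O-1

    O-+ : O x → O y → O (x + y)
    O-+ = let (_ , _ , O-+ , _) = convex in O-+ _ _

    O-neg : O x → O (- x)
    O-neg = let (_ , _ , _ , O-neg , _) = convex in O-neg _

    O-* : O x → O y → O (x * y)
    O-* = let (_ , _ , _ , _ , O-* , _) = convex in O-* _ _

    O-convex : ∀ {x y z} → O x → O z → x ≤ y → y ≤ z → O y
    O-convex = let (_ , _ , _ , _ , _ , O-convex) = convex in O-convex _ _ _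

    𝔪⊆O : 𝔪 x → O x
    𝔪⊆O = let (((𝔪⊆O , _) , _) , _) = maximal in 𝔪⊆O _

    𝔪-0 : 𝔪 0#
    𝔪-0 = let (((_ , 𝔪-0 , _) , _) , _) = maximal in 𝔪-0

    𝔪-+ : 𝔪 x → 𝔪 y → 𝔪 (x + y)
    𝔪-+ = let (((_ , _ , 𝔪-+ , _) , _) , _) = maximal in 𝔪-+ _ _

    𝔪-* : O x → 𝔪 y → 𝔪 (x * y)
    𝔪-* = let (((_ , _ , _ , 𝔪-*) , _) , _) = maximal in 𝔪-* _ _

    1∉𝔪 : ¬ 𝔪 1#
    1∉𝔪 = let ((_ , 1∉𝔪) , _) = maximal in 1∉𝔪

    fromℕ∈O : ∀ n → O (fromℕ n)
    fromℕ∈O 0               = O-0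
    fromℕ∈O 1               = O-1
    fromℕ∈O (suc n@(suc _)) = O-+ (fromℕ∈O n) O-1

    ∈O-if-between : ∀ n → 0# ≤ x → x ≤ fromℕ n → O x
    ∈O-if-between n = O-convex O-0 (fromℕ∈O n)

    𝔪-neg : 𝔪 x → 𝔪 (- x)
    𝔪-neg {x} x∈𝔪 = subst 𝔪 (-1*x≈-x x) (𝔪-* (O-neg O-1) x∈𝔪)

    𝔪-below-1 : 𝔪 x → ¬ 1# ≤ x
    𝔪-below-1 {x} x∈𝔪 1≤x =
      let (x⁻¹ , xx⁻¹≡1) = *-inverse λ x≡0 → 1≰0 (subst (1# ≤_) x≡0 1≤x)
          0≤x⁻¹ = *-inverse-nonneg (≤-trans 0≤1 1≤x) xx⁻¹≡1
          x⁻¹≤1 = subst₂ _≤_ (*-identityˡ x⁻¹) xx⁻¹≡1 (*-monoˡ-≤-nonNeg 0≤x⁻¹ 1≤x)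
      in 1∉𝔪 (subst 𝔪 (≡.trans (*-comm x⁻¹ x) xx⁻¹≡1) (𝔪-* (O-convex O-0 O-1 0≤x⁻¹ x⁻¹≤1) x∈𝔪))

    𝔪-<1 : 𝔪 x → x < 1#
    𝔪-<1 {x} x∈𝔪 =
      [ (λ x≤1 → x≤1 , λ x≡1 → 1∉𝔪 (subst 𝔪 x≡1 x∈𝔪)) , ⊥-elim ∘ 𝔪-below-1 x∈𝔪 ]′ (≤-total x 1#)

    𝔪⊆unitInterval : 𝔪 x → InUnitInterval x
    𝔪⊆unitInterval {x} x∈𝔪 =
      subst (- 1# <_) (-‿involutive x) (neg-mono-< (𝔪-<1 (𝔪-neg x∈𝔪))) , 𝔪-<1 x∈𝔪

    𝔪-abs : 𝔪 x → Σ[ m ∈ M ] 𝔪 m × ∣ x ∣≤ m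
    𝔪-abs {x} x∈𝔪 =
      [ (λ 0≤x → x , x∈𝔪 , ≤-trans (neg-nonpos 0≤x) 0≤x , ≤-refl)
      , (λ x≤0 → - x , 𝔪-neg x∈𝔪 , ≤-reflexive (-‿involutive x) , ≤-trans x≤0 (neg-nonneg x≤0))
      ]′ (≤-total 0# x)

    Dominated : M → Set
    Dominated x = O x × ¬ ¬ (Σ[ m ∈ M ] 𝔪 m × ∣ x ∣≤ m)

    Dominated-isProperIdeal : IsProperIdealOf O Dominated
    Dominated-isProperIdeal =
      ((λ _ → proj₁) , (O-0 , pure (0# , 𝔪-0 , ≤-reflexive -0#≈0# , ≤-refl)) , +-closed , *-closed) ,
      λ (_ , dominated) → dominated λ (m , m∈𝔪 , _ , 1≤m) → 𝔪-below-1 m∈𝔪 1≤m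
      where
      +-closed : ∀ x y → Dominated x → Dominated y → Dominated (x + y)
      +-closed x y (x∈O , x-dominated) (y∈O , y-dominated) = O-+ x∈O y∈O , do
        (m , m∈𝔪 , ∣x∣≤m) ← x-dominated
        (n , n∈𝔪 , ∣y∣≤n) ← y-dominated
        pure (m + n , 𝔪-+ m∈𝔪 n∈𝔪 , ∣∣≤-+ ∣x∣≤m ∣y∣≤n)

      *-closed : ∀ r x → O r → Dominated x → Dominated (r * x)
      *-closed r x r∈O (x∈O , x-dominated) = O-* r∈O x∈O , do
        (m , m∈𝔪 , ∣x∣≤m) ← x-dominated
        pure ([ (λ 0≤r → r * m , 𝔪-* r∈O m∈𝔪 , ∣∣≤-*-nonneg 0≤r ∣x∣≤m)
              , (λ r≤0 → - r * m , 𝔪-* (O-neg r∈O) m∈𝔪 ,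
                   subst (λ z → ∣ z ∣≤ - r * m) (-[-r*x]≡r*x r x)
                     (∣∣≤-neg (∣∣≤-*-nonneg (neg-nonneg r≤0) ∣x∣≤m)))
              ]′ (≤-total 0# r))
        where
        -[-r*x]≡r*x : ∀ r x → - (- r * x) ≡ r * x
        -[-r*x]≡r*x = solve 2 (λ r x → :- (:- r :* x) := r :* x) ≡.refl

    𝔪-downward-closed : O x → ¬ ¬ (Σ[ m ∈ M ] 𝔪 m × ∣ x ∣≤ m) → 𝔪 x
    𝔪-downward-closed {x} x∈O dominated =
      let (_ , 𝔪-maximal) = maximal
      in 𝔪-maximal Dominated Dominated-isProperIdeal (λ y y∈𝔪 → 𝔪⊆O y∈𝔪 , pure (𝔪-abs y∈𝔪))
           x (x∈O , dominated)

    ∈Units-if-bounded : ∀ n → ¬ ¬ ⅛ ≤ x → ¬ ¬ x ≤ fromℕ n → Units O x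
    ∈Units-if-bounded {x} n ⅛≤x x≤n = units (*-inverse x≢0)
      where
      0≤x : 0# ≤ x
      0≤x = <-¬¬-≤-trans ⅛-pos ⅛≤x

      x≢0 : x ≢ 0#
      x≢0 x≡0 = ⅛≤x λ ⅛≤x → <⇒≱ ⅛-pos (subst (⅛ ≤_) x≡0 ⅛≤x)

      units : Σ[ y ∈ M ] x * y ≡ 1# → Units O x
      units (x⁻¹ , xx⁻¹≡1) =
        ∈O-if-between (suc n) 0≤x (¬¬-≤-<-trans x≤n (fromℕ-<-suc n)) ,
        x⁻¹ ,
        ∈O-if-between 9 (*-inverse-nonneg 0≤x xx⁻¹≡1) (¬¬-≤-<-trans (x⁻¹≤8 <$> ⅛≤x) (fromℕ-<-suc 8)) ,
        xx⁻¹≡1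
        where
        open ≤-Reasoning
        x⁻¹≤8 : ⅛ ≤ x → x⁻¹ ≤ fromℕ 8
        x⁻¹≤8 ⅛≤x = begin
          x⁻¹                 ≡⟨ *-identityˡ x⁻¹ ⟨
          1# * x⁻¹            ≡⟨ cong (_* x⁻¹) 8*⅛≡1 ⟨
          fromℕ 8 * ⅛ * x⁻¹   ≡⟨ *-assoc (fromℕ 8) ⅛ x⁻¹ ⟩
          fromℕ 8 * (⅛ * x⁻¹) ≤⟨ *-monoʳ-≤-nonNeg (fromℕ-nonneg 8) (subst (⅛ * x⁻¹ ≤_) xx⁻¹≡1
                                   (*-monoˡ-≤-nonNeg (*-inverse-nonneg 0≤x xx⁻¹≡1) ⅛≤x)) ⟩
          fromℕ 8 * 1#        ≡⟨ *-identityʳ _ ⟩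
          fromℕ 8             ∎

proposition5p2 : (𝓜 : TexpStructure) → TexpStructure.IsModel 𝓜 →
    let open TexpStructure 𝓜 in
    (O 𝔪 : M → Set) → IsConvexSubring O → IsMaximalIdealOf O 𝔪 →
    (∀ x → InUnitInterval x → Units O (texp x))
    × (∀ x → 𝔪 x → Σ M λ y → 𝔪 y × (texp x ≡ 1# + y))
proposition5p2 𝓜 (ordered , complete , derivative , texp-0 , _) O 𝔪 convex maximal = texp-unit , texp-1+𝔪
  where
  open TexpStructure 𝓜
  open OrderedFieldProperties 𝓜 ordered
  open TexpEstimates 𝓜 ordered complete derivative texp-0
  open ConvexSubring 𝓜 ordered O 𝔪 convex maximal

  texp-unit : ∀ x → InUnitInterval x → Units O (texp x)
  texp-unit x x∈I =
    ∈Units-if-bounded 5 (TexpBounds.lower <$> texp-bounds x x∈I) (TexpBounds.upper <$> texp-bounds x x∈I)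

  texp-1+𝔪 : ∀ x → 𝔪 x → Σ M λ y → 𝔪 y × (texp x ≡ 1# + y)
  texp-1+𝔪 x x∈𝔪 =
    texp x - 1# ,
    𝔪-downward-closed (O-+ (proj₁ (texp-unit x x∈I)) (O-neg O-1)) (dominated <$> texp-bounds x x∈I) ,
    solve 1 (λ t → t := lit 1 :+ (t :- lit 1)) ≡.refl (texp x)
    where
    x∈I : InUnitInterval x
    x∈I = 𝔪⊆unitInterval x∈𝔪

    dominated : TexpBounds x → Σ[ n ∈ M ] 𝔪 n × ∣ texp x - 1# ∣≤ n
    dominated bounds =
      let (m , m∈𝔪 , ∣x∣≤m) = 𝔪-abs x∈𝔪
      in fromℕ 4 * m , 𝔪-* (fromℕ∈O 4) m∈𝔪 , TexpBounds.near-one bounds m ∣x∣≤m
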